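{- Let $G = K_{n_1,n_2,\ldots,n_r}$ be the complete $r$-partite graph with $r \ge 2$ and parts of sizes $n_1 \ge n_2 \ge \cdots \ge n_r \ge 1$, and let $n = n_1 + \cdots + n_r$. Suppose exactly $\alpha$ indices $i$ have $n_i$ odd. Then $$\mathrm{ip}(G) = \begin{cases} \lceil n_1/2 \rceil, & \text{if } 3n_1 > 2n;\\ \lceil (n+\alpha)/4 \rceil, & \text{if } 3\alpha > n;\\ \lceil n/3 \rceil, & \text{if } 3\alpha \le n \text{ and } 3n_1 \le 2n.\end{cases}$$
   Context: An isometric path between two vertices of a graph is a shortest path joining them. The isometric path number $\mathrm{ip}(G)$ of a graph $G$ is the minimum number of isometric paths needed to cover all vertices of $G$. The complete $r$-partite graph $K_{n_1,\ldots,n_r}$ has vertex set partitioned into $r$ nonempty parts of sizes $n_1,\ldots,n_r$, with two vertices adjacent if and only if they lie in different parts. -}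

module Defs where

open import Data.Nat using (ℕ; zero; suc; _+_; _≤_; _<_; _%_; _/_)
open import Data.Nat.Properties using (_≟_)
open import Data.Fin using (Fin)
open import Data.List using (List; []; _∷_; length; head; last; tabulate; filter)
open import Data.Nat.ListAction using (sum)
open import Data.List.Relation.Unary.All using (All)
open import Data.List.Relation.Unary.Any using (Any)
open import Data.List.Relation.Unary.Linked using (Linked)
open import Data.List.Relation.Unary.Unique.Propositional using (Unique)
open import Data.List.Membership.Propositional using (_∈_)
open import Data.Maybe using (just)
open import Data.Product using (Σ; _×_; ∃)
open import Relation.Binary.PropositionalEquality using (_≡_; _≢_)

record Graph : Set₁ where
  field
    V   : Set
    Adj : V → V → Set
open Graph public

module _ (G : Graph) where
  IsWalk : V G → V G → List (V G) → Set
  IsWalk u v xs = (head xs ≡ just u) × (last xs ≡ just v) × Linked (Adj G) xs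

  -- an isometric path: a path (distinct vertices) joining u and v that is a
  -- shortest walk between u and v (length counted in vertices).
  IsIsometricPath : List (V G) → Set
  IsIsometricPath xs = Σ (V G) λ u → Σ (V G) λ v →
    IsWalk u v xs × Unique xs × (∀ ws → IsWalk u v ws → length xs ≤ length ws)

  IsIsoPathCover : List (List (V G)) → Set
  IsIsoPathCover ps = All IsIsometricPath ps × (∀ (x : V G) → Any (x ∈_) ps)

  IsometricPathNumber : ℕ → Set
  IsometricPathNumber k =
    (Σ (List (List (V G))) λ ps → IsIsoPathCover ps × length ps ≡ k)
    × (∀ ps → IsIsoPathCover ps → k ≤ length ps)

CompleteMultipartite : (r : ℕ) → (Fin r → ℕ) → Graph
CompleteMultipartite r ns = record
  { V   = Σ (Fin r) (λ i → Fin (ns i))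
  ; Adj = λ x y → Data.Product.proj₁ x ≢ Data.Product.proj₁ y
  }

total : (r : ℕ) → (Fin r → ℕ) → ℕ
total r ns = sum (tabulate ns)

oddCount : (r : ℕ) → (Fin r → ℕ) → ℕ
oddCount r ns = length (filter (λ m → m % 2 ≟ 1) (tabulate ns))

-- ceiling division by a positive literal: ⌈ a / (suc b) ⌉
⌈_/suc_⌉ : ℕ → ℕ → ℕ
⌈ a /suc b ⌉ = (a + b) / suc b

{-# OPTIONS --safe #-}
-- A cover of K_{n₁,…,n_r} by k isometric paths forces three counting bounds. Any two
-- vertices are at distance at most 2, so an isometric path is a single vertex, an edge,
-- or a path x–y–z with x and z in one part: it has at most 3 vertices and meets at most
-- 2 parts, with at most 2 vertices in each. Hence n₁ ≤ 2k, n ≤ 3k, and, since a part of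
-- size nᵢ meets at least ⌈nᵢ/2⌉ paths, ∑ ⌈nᵢ/2⌉ = (n + α)/2 ≤ 2k.
--
-- Conversely these bounds suffice, by a greedy induction on k: take a largest part a and
-- a second part b, odd if possible, and cover two vertices of a and one of b by a path
-- a–b–a; the remaining sizes satisfy the bounds for k − 1. So ip(G) is the least k with
-- n₁ ≤ 2k, n ≤ 3k and n + α ≤ 4k, i.e. max(⌈n₁/2⌉, ⌈n/3⌉, ⌈(n+α)/4⌉), and each
-- hypothesis of the theorem says which of the three terms is the largest.
module Submission where

open import Data.Nat using (ℕ; zero; suc; _+_; _*_; _∸_; _≤_; _<_; _<?_; _≤?_; z≤n; s≤s; s≤s⁻¹; _%_; ⌈_/2⌉)
open import Data.Nat.Properties
open import Data.Nat.DivMod using (m≡m%n+[m/n]*n; m%n<n; m%n≤m; m<n*o⇒m/o<n)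
open import Data.Nat.ListAction using (sum)
open import Data.Nat.Solver using (module +-*-Solver)
open import Data.Fin using (Fin; zero; suc; toℕ; fromℕ<; punchIn; punchOut) renaming (_≟_ to _≟ᶠ_)
open import Data.Fin.Properties
  using (any?; injective⇒≤; fromℕ<-toℕ; toℕ-fromℕ<; toℕ<n; punchInᵢ≢i; punchIn-punchOut; punchOut-injective)
open import Data.List using (List; []; _∷_; [_]; _++_; length; filter; concat; map; take; lookup; tabulate; allFin)
open import Data.List.Properties using (filter-++; length-++; map-∘; length-take; map-tabulate)
open import Data.List.Extrema.Nat using (argmax; v≤f[argmax]⁺)
open import Data.List.Relation.Unary.All as All using (All; []; _∷_)
open import Data.List.Relation.Unary.Any as Any using (Any; here; there)
open import Data.List.Relation.Unary.Any.Properties using (lookup-index)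
open import Data.List.Relation.Unary.Linked using ([-]; _∷_)
open import Data.List.Relation.Unary.AllPairs using ([]; _∷_)
open import Data.List.Membership.Propositional using (_∈_)
open import Data.List.Membership.Propositional.Properties using (∈-filter⁺; ∈-concat⁺; ∈-allFin)
open import Data.Vec.Functional using (updateAt)
open import Data.Vec.Functional.Properties using (updateAt-updates; updateAt-minimal)
open import Algebra.Properties.CommutativeMonoid.Sum +-0-commutativeMonoid
  using (sum-remove; sum-cong-≗; ∑-distrib-+) renaming (sum to ∑)
open import Algebra.Properties.Semiring.Sum +-*-semiring using (*-distribˡ-sum)
open import Data.Product using (Σ; ∃; _×_; _,_; proj₁; proj₂)
open import Data.Sum using (inj₁; inj₂)
open import Function using (_∘_; Injective)
open import Relation.Binary.PropositionalEquality hiding ([_])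
open import Relation.Nullary using (¬_; Dec; yes; no; contradiction)
open import Relation.Nullary.Decidable using (¬?; _×-dec_)

open import Defs

open +-*-Solver

∑-mono-≤ : ∀ {r} {f g : Fin r → ℕ} → (∀ i → f i ≤ g i) → ∑ f ≤ ∑ g
∑-mono-≤ {zero}  f≤g = z≤n
∑-mono-≤ {suc r} f≤g = +-mono-≤ (f≤g zero) (∑-mono-≤ (f≤g ∘ suc))

∑-zero : ∀ {r} {f : Fin r → ℕ} → (∀ i → f i ≡ 0) → ∑ f ≡ 0
∑-zero {zero}  f≡0 = refl
∑-zero {suc r} f≡0 = cong₂ _+_ (f≡0 zero) (∑-zero (f≡0 ∘ suc))

point≤∑ : ∀ {r} (f : Fin r → ℕ) i → f i ≤ ∑ f
point≤∑ {suc r} f i = ≤-trans (m≤m+n (f i) _) (≤-reflexive (sym (sum-remove {i = i} f)))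

private
  f-punchIn-punchOut : ∀ {r} (f : Fin (suc r) → ℕ) {i j} (i≢j : i ≢ j) → f j ≡ f (punchIn i (punchOut i≢j))
  f-punchIn-punchOut f i≢j = cong f (sym (punchIn-punchOut i≢j))

pair≤∑ : ∀ {r} (f : Fin r → ℕ) {i j} → i ≢ j → f i + f j ≤ ∑ f
pair≤∑ {suc r} f {i} {j} i≢j = begin
  f i + f j                   ≡⟨ cong (f i +_) (f-punchIn-punchOut f i≢j) ⟩
  f i + f (punchIn i _)       ≤⟨ +-monoʳ-≤ (f i) (point≤∑ (f ∘ punchIn i) (punchOut i≢j)) ⟩
  f i + ∑ (f ∘ punchIn i)     ≡⟨ sum-remove f ⟨
  ∑ f                         ∎
  where open ≤-Reasoning

triple≤∑ : ∀ {r} (f : Fin r → ℕ) {i j k} → i ≢ j → i ≢ k → j ≢ k → f i + (f j + f k) ≤ ∑ f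
triple≤∑ {suc r} f {i} {j} {k} i≢j i≢k j≢k = begin
  f i + (f j + f k)
    ≡⟨ cong (f i +_) (cong₂ _+_ (f-punchIn-punchOut f i≢j) (f-punchIn-punchOut f i≢k)) ⟩
  f i + (f (punchIn i _) + f (punchIn i _))
    ≤⟨ +-monoʳ-≤ (f i) (pair≤∑ (f ∘ punchIn i) (j≢k ∘ punchOut-injective i≢j i≢k)) ⟩
  f i + ∑ (f ∘ punchIn i)
    ≡⟨ sum-remove f ⟨
  ∑ f ∎
  where open ≤-Reasoning

∑-concentrated : ∀ {r} {f : Fin r → ℕ} i → (∀ j → j ≢ i → f j ≡ 0) → ∑ f ≡ f i
∑-concentrated {suc r} {f} i vanish = begin
  ∑ f                       ≡⟨ sum-remove f ⟩
  f i + ∑ (f ∘ punchIn i)   ≡⟨ cong (f i +_) (∑-zero (λ k → vanish (punchIn i k) (punchInᵢ≢i i k))) ⟩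
  f i + 0                   ≡⟨ +-identityʳ (f i) ⟩
  f i                       ∎
  where open ≡-Reasoning

∑-update : ∀ {r} {f g : Fin r → ℕ} i → (∀ j → j ≢ i → g j ≡ f j) → ∑ g + f i ≡ ∑ f + g i
∑-update {suc r} {f} {g} i agree = begin
  ∑ g + f i                           ≡⟨ cong (_+ f i) (sum-remove g) ⟩
  g i + ∑ (g ∘ punchIn i) + f i       ≡⟨ cong (λ s → g i + s + f i) rest ⟩
  g i + ∑ (f ∘ punchIn i) + f i       ≡⟨ solve 3 (λ x s y → x :+ s :+ y := y :+ s :+ x) refl (g i) _ (f i) ⟩
  f i + ∑ (f ∘ punchIn i) + g i       ≡⟨ cong (_+ g i) (sum-remove f) ⟨
  ∑ f + g i                           ∎
  where
  open ≡-Reasoning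
  rest : ∑ (g ∘ punchIn i) ≡ ∑ (f ∘ punchIn i)
  rest = sum-cong-≗ (λ k → agree (punchIn i k) (punchInᵢ≢i i k))

n+n%2≡2⌈n/2⌉ : ∀ n → n + n % 2 ≡ 2 * ⌈ n /2⌉
n+n%2≡2⌈n/2⌉ zero          = refl
n+n%2≡2⌈n/2⌉ (suc zero)    = refl
n+n%2≡2⌈n/2⌉ (suc (suc n)) = trans (cong (2 +_) (n+n%2≡2⌈n/2⌉ n)) (sym (*-suc 2 ⌈ n /2⌉))

n%2≤1 : ∀ n → n % 2 ≤ 1
n%2≤1 n = s≤s⁻¹ (m%n<n n 2)

n≤2⌈n/2⌉ : ∀ n → n ≤ 2 * ⌈ n /2⌉
n≤2⌈n/2⌉ n = ≤-trans (m≤m+n n (n % 2)) (≤-reflexive (n+n%2≡2⌈n/2⌉ n))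

n≤2k⇒⌈n/2⌉≤k : ∀ {n k} → n ≤ 2 * k → ⌈ n /2⌉ ≤ k
n≤2k⇒⌈n/2⌉≤k {n} {k} n≤2k = s≤s⁻¹ (*-cancelˡ-< 2 ⌈ n /2⌉ (suc k) (begin-strict
  2 * ⌈ n /2⌉   ≡⟨ n+n%2≡2⌈n/2⌉ n ⟨
  n + n % 2     ≤⟨ +-mono-≤ n≤2k (n%2≤1 n) ⟩
  2 * k + 1     <⟨ +-monoʳ-< (2 * k) (n<1+n 1) ⟩
  2 * k + 2     ≡⟨ solve 1 (λ k → con 2 :* k :+ con 2 := con 2 :* (con 1 :+ k)) refl k ⟩
  2 * suc k     ∎))
  where open ≤-Reasoning

n≤1⇒n≤⌈n/2⌉ : ∀ {n} → n ≤ 1 → n ≤ ⌈ n /2⌉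
n≤1⇒n≤⌈n/2⌉ {zero}        _        = z≤n
n≤1⇒n≤⌈n/2⌉ {suc zero}    _        = ≤-refl
n≤1⇒n≤⌈n/2⌉ {suc (suc _)} (s≤s ())

⌈m+n/2⌉≤⌈m/2⌉+⌈n/2⌉ : ∀ m n → ⌈ m + n /2⌉ ≤ ⌈ m /2⌉ + ⌈ n /2⌉
⌈m+n/2⌉≤⌈m/2⌉+⌈n/2⌉ zero          n = ≤-refl
⌈m+n/2⌉≤⌈m/2⌉+⌈n/2⌉ (suc zero)    n = s≤s (⌊n/2⌋≤⌈n/2⌉ n)
⌈m+n/2⌉≤⌈m/2⌉+⌈n/2⌉ (suc (suc m)) n = s≤s (⌈m+n/2⌉≤⌈m/2⌉+⌈n/2⌉ m n)

⌈sum/2⌉≤sum⌈/2⌉ : ∀ xs → ⌈ sum xs /2⌉ ≤ sum (map ⌈_/2⌉ xs)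
⌈sum/2⌉≤sum⌈/2⌉ []       = z≤n
⌈sum/2⌉≤sum⌈/2⌉ (x ∷ xs) =
  ≤-trans (⌈m+n/2⌉≤⌈m/2⌉+⌈n/2⌉ x (sum xs)) (+-monoʳ-≤ ⌈ x /2⌉ (⌈sum/2⌉≤sum⌈/2⌉ xs))

⌈n/2⌉≡1+⌈n∸2/2⌉ : ∀ {n} → 1 ≤ n → ⌈ n /2⌉ ≡ 1 + ⌈ n ∸ 2 /2⌉
⌈n/2⌉≡1+⌈n∸2/2⌉ {suc zero}    _ = refl
⌈n/2⌉≡1+⌈n∸2/2⌉ {suc (suc n)} _ = refl

⌈n/2⌉≡⌈n∸1/2⌉+n%2 : ∀ n → ⌈ n /2⌉ ≡ ⌈ n ∸ 1 /2⌉ + n % 2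
⌈n/2⌉≡⌈n∸1/2⌉+n%2 zero    = refl
⌈n/2⌉≡⌈n∸1/2⌉+n%2 (suc n) = ⌈1+n/2⌉≡⌈n/2⌉+[1+n]%2 n
  where
  ⌈1+n/2⌉≡⌈n/2⌉+[1+n]%2 : ∀ n → ⌈ suc n /2⌉ ≡ ⌈ n /2⌉ + suc n % 2
  ⌈1+n/2⌉≡⌈n/2⌉+[1+n]%2 zero          = refl
  ⌈1+n/2⌉≡⌈n/2⌉+[1+n]%2 (suc zero)    = refl
  ⌈1+n/2⌉≡⌈n/2⌉+[1+n]%2 (suc (suc n)) = cong suc (⌈1+n/2⌉≡⌈n/2⌉+[1+n]%2 n)

size+odd≡2*halves : ∀ {r} (c : Fin r → ℕ) → ∑ c + ∑ (λ i → c i % 2) ≡ 2 * ∑ (⌈_/2⌉ ∘ c)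
size+odd≡2*halves c = begin
  ∑ c + ∑ (λ i → c i % 2)       ≡⟨ ∑-distrib-+ c (λ i → c i % 2) ⟨
  ∑ (λ i → c i + c i % 2)       ≡⟨ sum-cong-≗ (n+n%2≡2⌈n/2⌉ ∘ c) ⟩
  ∑ (λ i → 2 * ⌈ c i /2⌉)       ≡⟨ *-distribˡ-sum 2 (⌈_/2⌉ ∘ c) ⟨
  2 * ∑ (⌈_/2⌉ ∘ c)             ∎
  where open ≡-Reasoning

-- Counting bounds and the greedy step

-- Necessary for covering parts of sizes c by k isometric paths (cover-bounds), and
-- sufficient when there are at least two parts (build).
record PathBounds {r} (k : ℕ) (c : Fin r → ℕ) : Set where
  field
    parts  : ∀ i → c i ≤ 2 * k
    size   : ∑ c ≤ 3 * k
    halves : ∑ (⌈_/2⌉ ∘ c) ≤ 2 * k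

takePath : ∀ {r} → Fin r → Fin r → (Fin r → ℕ) → Fin r → ℕ
takePath a b c = updateAt (updateAt c a (_∸ 2)) b (_∸ 1)

module TakePath {r} {a b : Fin r} (a≢b : a ≢ b) (c : Fin r → ℕ) where

  private
    c₁ = updateAt c a (_∸ 2)
    c₂ = takePath a b c

  at-a : c₂ a ≡ c a ∸ 2
  at-a = trans (updateAt-minimal a b c₁ a≢b) (updateAt-updates a c)

  at-b : c₂ b ≡ c b ∸ 1
  at-b = trans (updateAt-updates b c₁) (cong (_∸ 1) (updateAt-minimal b a c (a≢b ∘ sym)))

  elsewhere : ∀ i → i ≢ a → i ≢ b → c₂ i ≡ c i
  elsewhere i i≢a i≢b = trans (updateAt-minimal i b c₁ i≢b) (updateAt-minimal i a c i≢a)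

  decreasing : ∀ i → c₂ i ≤ c i
  decreasing i with i ≟ᶠ a | i ≟ᶠ b
  ... | yes refl | _        = ≤-trans (≤-reflexive at-a) (m∸n≤m (c a) 2)
  ... | no _     | yes refl = ≤-trans (≤-reflexive at-b) (m∸n≤m (c b) 1)
  ... | no i≢a   | no i≢b   = ≤-reflexive (elsewhere i i≢a i≢b)

  ∑-∘-takePath : (f : ℕ → ℕ) →
                 ∑ (f ∘ c₂) + f (c a) + f (c b) ≡ ∑ (f ∘ c) + f (c a ∸ 2) + f (c b ∸ 1)
  ∑-∘-takePath f = begin
    ∑ (f ∘ c₂) + f (c a) + f (c b)
      ≡⟨ swap (∑ (f ∘ c₂)) (f (c a)) (f (c b)) ⟩
    ∑ (f ∘ c₂) + f (c b) + f (c a)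
      ≡⟨ cong (λ v → ∑ (f ∘ c₂) + f v + f (c a)) c₁b ⟨
    ∑ (f ∘ c₂) + f (c₁ b) + f (c a)
      ≡⟨ cong (_+ f (c a)) (∑-update b (λ i i≢b → cong f (updateAt-minimal i b c₁ i≢b))) ⟩
    ∑ (f ∘ c₁) + f (c₂ b) + f (c a)
      ≡⟨ swap (∑ (f ∘ c₁)) (f (c₂ b)) (f (c a)) ⟩
    ∑ (f ∘ c₁) + f (c a) + f (c₂ b)
      ≡⟨ cong (_+ f (c₂ b)) (∑-update a (λ i i≢a → cong f (updateAt-minimal i a c i≢a))) ⟩
    ∑ (f ∘ c) + f (c₁ a) + f (c₂ b)
      ≡⟨ cong₂ (λ u v → ∑ (f ∘ c) + f u + f v) (updateAt-updates a c) at-b ⟩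
    ∑ (f ∘ c) + f (c a ∸ 2) + f (c b ∸ 1) ∎
    where
    open ≡-Reasoning
    swap : ∀ s x y → s + x + y ≡ s + y + x
    swap = solve 3 (λ s x y → s :+ x :+ y := s :+ y :+ x) refl
    c₁b : c₁ b ≡ c b
    c₁b = updateAt-minimal b a c (a≢b ∘ sym)

  ∑-takePath : 2 ≤ c a → 1 ≤ c b → ∑ c₂ + 3 ≡ ∑ c
  ∑-takePath 2≤ca 1≤cb = +-cancelʳ-≡ (c a ∸ 2 + (c b ∸ 1)) _ _ (begin
    ∑ c₂ + 3 + (c a ∸ 2 + (c b ∸ 1))
      ≡⟨ solve 3 (λ s x y → s :+ con 3 :+ (x :+ y) := s :+ (x :+ con 2) :+ (y :+ con 1)) refl (∑ c₂) _ _ ⟩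
    ∑ c₂ + (c a ∸ 2 + 2) + (c b ∸ 1 + 1)
      ≡⟨ cong₂ (λ x y → ∑ c₂ + x + y) (m∸n+n≡m 2≤ca) (m∸n+n≡m 1≤cb) ⟩
    ∑ c₂ + c a + c b
      ≡⟨ ∑-∘-takePath (λ x → x) ⟩
    ∑ c + (c a ∸ 2) + (c b ∸ 1)
      ≡⟨ +-assoc (∑ c) _ _ ⟩
    ∑ c + (c a ∸ 2 + (c b ∸ 1)) ∎)
    where open ≡-Reasoning

  ∑⌈/2⌉-takePath : 1 ≤ c a → ∑ (⌈_/2⌉ ∘ c₂) + (1 + c b % 2) ≡ ∑ (⌈_/2⌉ ∘ c)
  ∑⌈/2⌉-takePath 1≤ca = +-cancelʳ-≡ (⌈ c a ∸ 2 /2⌉ + ⌈ c b ∸ 1 /2⌉) _ _ (begin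
    H₂ + (1 + c b % 2) + (⌈ c a ∸ 2 /2⌉ + ⌈ c b ∸ 1 /2⌉)
      ≡⟨ solve 4 (λ s p x y → s :+ (con 1 :+ p) :+ (x :+ y) := s :+ (con 1 :+ x) :+ (y :+ p)) refl H₂ (c b % 2) _ _ ⟩
    H₂ + (1 + ⌈ c a ∸ 2 /2⌉) + (⌈ c b ∸ 1 /2⌉ + c b % 2)
      ≡⟨ cong₂ (λ x y → H₂ + x + y) (⌈n/2⌉≡1+⌈n∸2/2⌉ 1≤ca) (⌈n/2⌉≡⌈n∸1/2⌉+n%2 (c b)) ⟨
    H₂ + ⌈ c a /2⌉ + ⌈ c b /2⌉
      ≡⟨ ∑-∘-takePath ⌈_/2⌉ ⟩
    ∑ (⌈_/2⌉ ∘ c) + ⌈ c a ∸ 2 /2⌉ + ⌈ c b ∸ 1 /2⌉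
      ≡⟨ +-assoc (∑ (⌈_/2⌉ ∘ c)) _ _ ⟩
    ∑ (⌈_/2⌉ ∘ c) + (⌈ c a ∸ 2 /2⌉ + ⌈ c b ∸ 1 /2⌉) ∎)
    where
    open ≡-Reasoning
    H₂ = ∑ (⌈_/2⌉ ∘ c₂)

largest : ∀ {n} (c : Fin (suc n) → ℕ) → Σ (Fin (suc n)) λ a → ∀ i → c i ≤ c a
largest c = argmax c zero (allFin _) ,
  λ i → v≤f[argmax]⁺ zero (allFin _) (inj₂ (Any.map (≤-reflexive ∘ cong c) (∈-allFin i)))

another : ∀ {n} → Fin (2 + n) → Fin (2 + n)
another zero    = suc zero
another (suc _) = zero

another≢ : ∀ {n} (a : Fin (2 + n)) → another a ≢ a
another≢ zero    ()
another≢ (suc _) ()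

data Partner {r} (c : Fin r → ℕ) (a : Fin r) : Set where
  odd   : ∀ {b} → b ≢ a → c b % 2 ≡ 1 → Partner c a
  even  : ∀ {b} → b ≢ a → 1 ≤ c b → (∀ i → i ≢ a → c i % 2 ≡ 0) → Partner c a
  alone : ∀ {b} → b ≢ a → (∀ i → i ≢ a → c i ≡ 0) → Partner c a

partner : ∀ {n} (c : Fin (2 + n) → ℕ) a → Partner c a
partner c a with any? (λ b → ¬? (b ≟ᶠ a) ×-dec (c b % 2 ≟ 1))
... | yes (b , b≢a , odd-b) = odd b≢a odd-b
... | no no-odd with any? (λ b → ¬? (b ≟ᶠ a) ×-dec (1 ≤? c b))
...   | yes (b , b≢a , 1≤cb) = even b≢a 1≤cb (λ i i≢a → even-i i (λ odd-i → no-odd (i , i≢a , odd-i)))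
  where
  even-i : ∀ i → c i % 2 ≢ 1 → c i % 2 ≡ 0
  even-i i ≢1 with n≤1⇒n≡0∨n≡1 (n%2≤1 (c i))
  ... | inj₁ ≡0 = ≡0
  ... | inj₂ ≡1 = contradiction ≡1 ≢1
...   | no no-pos = alone (another≢ a) (λ i i≢a → n<1⇒n≡0 (≰⇒> (λ 1≤ci → no-pos (i , i≢a , 1≤ci))))

concentrated-bounds : ∀ {r k} {d : Fin r → ℕ} a → (∀ i → i ≢ a → d i ≡ 0) → d a ≤ 2 * k → PathBounds k d
concentrated-bounds {k = k} {d} a vanish da≤2k = record
  { parts  = parts
  ; size   = ≤-trans (≤-reflexive (∑-concentrated a vanish)) (≤-trans da≤2k (*-monoˡ-≤ k (n≤1+n 2)))
  ; halves = ≤-trans (≤-reflexive (∑-concentrated a (λ i i≢a → cong ⌈_/2⌉ (vanish i i≢a))))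
                     (≤-trans (n≤2k⇒⌈n/2⌉≤k da≤2k) (m≤n*m k 2))
  }
  where
  parts : ∀ i → d i ≤ 2 * k
  parts i with i ≟ᶠ a
  ... | yes refl = da≤2k
  ... | no i≢a   = ≤-trans (≤-reflexive (vanish i i≢a)) z≤n

private
  cancel-+ : ∀ d {x y m} → x + d ≡ y → y ≤ d + m → x ≤ m
  cancel-+ d {x} x+d≡y y≤d+m = +-cancelˡ-≤ d x _ (≤-trans (≤-reflexive (trans (+-comm d x) x+d≡y)) y≤d+m)

  ∸2≤ : ∀ {x k} → x ≤ 2 * suc k → x ∸ 2 ≤ 2 * k
  ∸2≤ {x} {k} x≤ =
    ≤-trans (∸-monoˡ-≤ 2 x≤) (≤-reflexive (trans (cong (_∸ 2) (*-suc 2 k)) (m+n∸m≡n 2 (2 * k))))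

  smaller∸1≤ : ∀ {x y k} → y ≤ x → x + y ≤ 3 * suc k → y ∸ 1 ≤ 2 * k
  smaller∸1≤ {x} {y} {k} y≤x x+y≤ = ∸-monoˡ-≤ 1 (s≤s⁻¹ (*-cancelˡ-< 2 y (2 + 2 * k) (begin-strict
    2 * y             ≡⟨ solve 1 (λ y → con 2 :* y := y :+ y) refl y ⟩
    y + y             ≤⟨ +-monoˡ-≤ y y≤x ⟩
    x + y             ≤⟨ x+y≤ ⟩
    3 * suc k         ≡⟨ *-suc 3 k ⟩
    3 + 3 * k         <⟨ s≤s (+-monoʳ-≤ 3 (*-monoˡ-≤ k (n≤1+n 3))) ⟩
    4 + 4 * k         ≡⟨ solve 1 (λ k → con 4 :+ con 4 :* k := con 2 :* (con 2 :+ con 2 :* k)) refl k ⟩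
    2 * (2 + 2 * k)   ∎)))
    where open ≤-Reasoning

  third≤ : ∀ {x y z k} → z ≤ x → 1 ≤ y → x + (y + z) ≤ 2 * suc k → z ≤ k
  third≤ {x} {y} {z} {k} z≤x 1≤y sum≤ = s≤s⁻¹ (*-cancelˡ-< 2 z (suc k) (begin-strict
    2 * z             ≡⟨ solve 1 (λ z → con 2 :* z := z :+ z) refl z ⟩
    z + z             <⟨ +-monoʳ-< z (n<1+n z) ⟩
    z + (1 + z)       ≤⟨ +-mono-≤ z≤x (+-monoˡ-≤ z 1≤y) ⟩
    x + (y + z)       ≤⟨ sum≤ ⟩
    2 * suc k         ∎))
    where open ≤-Reasoning

  half≤ : ∀ {h n k} → 2 * h ≤ n + 1 → 4 ≤ n → n ≤ 3 * suc k → h ≤ suc (2 * k)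
  half≤ {k = zero}  _ 4≤n n≤3 = contradiction (≤-trans 4≤n n≤3) 1+n≰n
  half≤ {h} {n} {suc j} 2h≤ _ n≤ = s≤s⁻¹ (*-cancelˡ-< 2 h (2 + 2 * suc j) (begin-strict
    2 * h                  ≤⟨ 2h≤ ⟩
    n + 1                  ≤⟨ +-monoˡ-≤ 1 n≤ ⟩
    3 * suc (suc j) + 1    ≡⟨ solve 1 (λ j → con 3 :* (con 2 :+ j) :+ con 1 := con 7 :+ con 3 :* j) refl j ⟩
    7 + 3 * j              <⟨ s≤s (+-monoʳ-≤ 7 (*-monoˡ-≤ j (n≤1+n 3))) ⟩
    8 + 4 * j              ≡⟨ solve 1 (λ j → con 8 :+ con 4 :* j := con 2 :* (con 2 :+ con 2 :* (con 1 :+ j))) refl j ⟩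
    2 * (2 + 2 * suc j)    ∎))
    where open ≤-Reasoning

  odd⇒1≤ : ∀ {m} → m % 2 ≡ 1 → 1 ≤ m
  odd⇒1≤ {suc _} _ = s≤s z≤n

  even⇒2≤ : ∀ {m} → m % 2 ≡ 0 → 1 ≤ m → 2 ≤ m
  even⇒2≤ {suc (suc _)} _ _ = s≤s (s≤s z≤n)

-- A path a–b–a lowers ∑ ⌈c/2⌉ by 2 when c b is odd. If no part other than a is odd,
-- n + α ≤ n + 1 and this parity slack (half≤) makes a drop by 1 enough.
module _ {n k} {c : Fin (2 + n) → ℕ} (bounds : PathBounds (suc k) c)
         {a : Fin (2 + n)} (max : ∀ i → c i ≤ c a) where
  open PathBounds bounds

  parts-takePath : ∀ {b} (a≢b : a ≢ b) → 1 ≤ c b → ∀ i → takePath a b c i ≤ 2 * k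
  parts-takePath {b} a≢b 1≤cb i with i ≟ᶠ a | i ≟ᶠ b
  ... | yes refl | _        = ≤-trans (≤-reflexive (TakePath.at-a a≢b c)) (∸2≤ (parts a))
  ... | no _     | yes refl =
    ≤-trans (≤-reflexive (TakePath.at-b a≢b c)) (smaller∸1≤ (max b) (≤-trans (pair≤∑ c a≢b) size))
  ... | no i≢a   | no i≢b   = begin
    takePath a b c i    ≡⟨ TakePath.elsewhere a≢b c i i≢a i≢b ⟩
    c i                 ≤⟨ n≤2⌈n/2⌉ (c i) ⟩
    2 * ⌈ c i /2⌉       ≤⟨ *-monoʳ-≤ 2 (third≤ (⌈n/2⌉-mono (max i)) (⌈n/2⌉-mono 1≤cb) ha+hb+hi≤) ⟩
    2 * k               ∎
    where
    open ≤-Reasoning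
    ha+hb+hi≤ = ≤-trans (triple≤∑ (⌈_/2⌉ ∘ c) a≢b (i≢a ∘ sym) (i≢b ∘ sym)) halves

  odd-partner-bounds : ∀ {b} → a ≢ b → c b % 2 ≡ 1 → PathBounds k (takePath a b c)
  odd-partner-bounds {b} a≢b odd-b = record
    { parts  = parts-takePath a≢b 1≤cb
    ; size   = size′ (2 ≤? c a)
    ; halves = halves′
    }
    where
    open TakePath a≢b c
    1≤cb = odd⇒1≤ odd-b
    halves′ : ∑ (⌈_/2⌉ ∘ takePath a b c) ≤ 2 * k
    halves′ = cancel-+ 2 drop (≤-trans halves (≤-reflexive (*-suc 2 k)))
      where
      drop : ∑ (⌈_/2⌉ ∘ takePath a b c) + 2 ≡ ∑ (⌈_/2⌉ ∘ c)
      drop = subst (λ p → ∑ (⌈_/2⌉ ∘ takePath a b c) + (1 + p) ≡ ∑ (⌈_/2⌉ ∘ c)) odd-b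
                   (∑⌈/2⌉-takePath (≤-trans 1≤cb (max b)))
    size′ : Dec (2 ≤ c a) → ∑ (takePath a b c) ≤ 3 * k
    size′ (yes 2≤ca) = cancel-+ 3 (∑-takePath 2≤ca 1≤cb) (≤-trans size (≤-reflexive (*-suc 3 k)))
    size′ (no ca≱2)  = begin
      ∑ (takePath a b c)           ≤⟨ ∑-mono-≤ (λ i → n≤1⇒n≤⌈n/2⌉ (c₂≤1 i)) ⟩
      ∑ (⌈_/2⌉ ∘ takePath a b c)   ≤⟨ halves′ ⟩
      2 * k                        ≤⟨ *-monoˡ-≤ k (n≤1+n 2) ⟩
      3 * k                        ∎
      where
      open ≤-Reasoning
      c₂≤1 : ∀ i → takePath a b c i ≤ 1
      c₂≤1 i = ≤-trans (decreasing i) (≤-trans (max i) (s≤s⁻¹ (≰⇒> ca≱2)))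

  even-partner-bounds : ∀ {b} → a ≢ b → 1 ≤ c b → (∀ i → i ≢ a → c i % 2 ≡ 0) →
                        PathBounds k (takePath a b c)
  even-partner-bounds {b} a≢b 1≤cb evens = record
    { parts  = parts-takePath a≢b 1≤cb
    ; size   = cancel-+ 3 (∑-takePath 2≤ca 1≤cb) (≤-trans size (≤-reflexive (*-suc 3 k)))
    ; halves = cancel-+ 1 drop (half≤ 2H≤n+1 (≤-trans (+-mono-≤ 2≤ca 2≤cb) (pair≤∑ c a≢b)) size)
    }
    where
    open TakePath a≢b c
    2≤cb = even⇒2≤ (evens b (a≢b ∘ sym)) 1≤cb
    2≤ca = ≤-trans 2≤cb (max b)
    drop : ∑ (⌈_/2⌉ ∘ takePath a b c) + 1 ≡ ∑ (⌈_/2⌉ ∘ c)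
    drop = subst (λ p → ∑ (⌈_/2⌉ ∘ takePath a b c) + (1 + p) ≡ ∑ (⌈_/2⌉ ∘ c)) (evens b (a≢b ∘ sym))
                 (∑⌈/2⌉-takePath (≤-trans 1≤cb (max b)))
    2H≤n+1 : 2 * ∑ (⌈_/2⌉ ∘ c) ≤ ∑ c + 1
    2H≤n+1 = begin
      2 * ∑ (⌈_/2⌉ ∘ c)          ≡⟨ size+odd≡2*halves c ⟨
      ∑ c + ∑ (λ i → c i % 2)    ≡⟨ cong (∑ c +_) (∑-concentrated a evens) ⟩
      ∑ c + c a % 2              ≤⟨ +-monoʳ-≤ (∑ c) (n%2≤1 (c a)) ⟩
      ∑ c + 1                    ∎
      where open ≤-Reasoning

  lone-part-bounds : ∀ {b} → a ≢ b → (∀ i → i ≢ a → c i ≡ 0) → PathBounds k (takePath a b c)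
  lone-part-bounds a≢b vanish = concentrated-bounds a
    (λ i i≢a → n≤0⇒n≡0 (≤-trans (decreasing i) (≤-reflexive (vanish i i≢a))))
    (≤-trans (≤-reflexive at-a) (∸2≤ (parts a)))
    where open TakePath a≢b c

  takePath-bounds : ∃ λ b → a ≢ b × PathBounds k (takePath a b c)
  takePath-bounds with partner c a
  ... | odd   b≢a odd-b      = _ , b≢a ∘ sym , odd-partner-bounds (b≢a ∘ sym) odd-b
  ... | even  b≢a 1≤cb evens = _ , b≢a ∘ sym , even-partner-bounds (b≢a ∘ sym) 1≤cb evens
  ... | alone b≢a vanish     = _ , b≢a ∘ sym , lone-part-bounds (b≢a ∘ sym) vanish

injection≤length : ∀ {a} {A : Set a} {n} {xs : List A} (f : Fin n → A) →
                   Injective _≡_ _≡_ f → (∀ j → f j ∈ xs) → n ≤ length xs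
injection≤length {xs = xs} f f-inj f∈xs = injective⇒≤ λ {j} {j′} same-index → f-inj (begin
  f j                              ≡⟨ lookup-index (f∈xs j) ⟩
  lookup xs (Any.index (f∈xs j))   ≡⟨ cong (lookup xs) same-index ⟩
  lookup xs (Any.index (f∈xs j′))  ≡⟨ lookup-index (f∈xs j′) ⟨
  f j′                             ∎)
  where open ≡-Reasoning

sum-map-mono : ∀ {a} {A : Set a} {f g : A → ℕ} {xs} → All (λ x → f x ≤ g x) xs → sum (map f xs) ≤ sum (map g xs)
sum-map-mono []          = z≤n
sum-map-mono (fx≤ ∷ f≤g) = +-mono-≤ fx≤ (sum-map-mono f≤g)

sum-map-≤* : ∀ {a} {A : Set a} {f : A → ℕ} {m xs} → All (λ x → f x ≤ m) xs → sum (map f xs) ≤ m * length xs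
sum-map-≤* {m = m} []                   = ≤-reflexive (sym (*-zeroʳ m))
sum-map-≤* {m = m} {_ ∷ xs} (fx≤ ∷ f≤m) =
  ≤-trans (+-mono-≤ fx≤ (sum-map-≤* f≤m)) (≤-reflexive (sym (*-suc m (length xs))))

length-concat : ∀ {a} {A : Set a} (xss : List (List A)) → length (concat xss) ≡ sum (map length xss)
length-concat []         = refl
length-concat (xs ∷ xss) = trans (length-++ xs) (cong (length xs +_) (length-concat xss))

-- Isometric paths in complete multipartite graphs

module Multipartite {r} (ns : Fin r → ℕ) where

  G : Graph
  G = CompleteMultipartite r ns

  Vertex : Set
  Vertex = V G

  part : Vertex → Fin r
  part = proj₁

  one-vertex-walk : ∀ {u v w} → IsWalk G u v (w ∷ []) → u ≡ v
  one-vertex-walk (refl , refl , _) = refl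

  two-vertex-walk : ∀ {u v w w′} → IsWalk G u v (w ∷ w′ ∷ []) → part u ≢ part v
  two-vertex-walk (refl , refl , u≁v ∷ _) = u≁v

  edge-isometric : ∀ {x y} → part x ≢ part y → IsIsometricPath G (x ∷ y ∷ [])
  edge-isometric {x} {y} x≁y =
    x , y , (refl , refl , x≁y ∷ [-]) , ((x≁y ∘ cong part) ∷ []) ∷ [] ∷ [] , shortest
    where
    shortest : ∀ ws → IsWalk G x y ws → 2 ≤ length ws
    shortest []          (() , _)
    shortest (_ ∷ [])    walk = contradiction (cong part (one-vertex-walk walk)) x≁y
    shortest (_ ∷ _ ∷ _) _    = s≤s (s≤s z≤n)

  bend-isometric : ∀ {x y z} → part x ≢ part y → part z ≡ part x → x ≢ z →
                   IsIsometricPath G (x ∷ y ∷ z ∷ [])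
  bend-isometric {x} {y} {z} x≁y z∼x x≢z =
    x , z , (refl , refl , x≁y ∷ y≁z ∷ [-]) ,
    ((x≁y ∘ cong part) ∷ x≢z ∷ []) ∷ ((y≁z ∘ cong part) ∷ []) ∷ [] ∷ [] , shortest
    where
    y≁z : part y ≢ part z
    y≁z y∼z = x≁y (sym (trans y∼z z∼x))
    shortest : ∀ ws → IsWalk G x z ws → 3 ≤ length ws
    shortest []              (() , _)
    shortest (_ ∷ [])        walk = contradiction (one-vertex-walk walk) x≢z
    shortest (_ ∷ _ ∷ [])    walk = contradiction (sym z∼x) (two-vertex-walk walk)
    shortest (_ ∷ _ ∷ _ ∷ _) _    = s≤s (s≤s (s≤s z≤n))

  data Shape : List Vertex → Set where
    point : ∀ x → Shape (x ∷ [])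
    edge  : ∀ {x y} → part x ≢ part y → Shape (x ∷ y ∷ [])
    bend  : ∀ {x y z} → part x ≢ part y → part z ≡ part x → Shape (x ∷ y ∷ z ∷ [])

  module _ (outside : ∀ i → Σ Vertex λ w → part w ≢ i) where

    walk≤3 : ∀ u v → Σ (List Vertex) λ ws → IsWalk G u v ws × length ws ≤ 3
    walk≤3 u v with part u ≟ᶠ part v
    ... | no u≁v  = u ∷ v ∷ [] , (refl , refl , u≁v ∷ [-]) , s≤s (s≤s z≤n)
    ... | yes u∼v = u ∷ w ∷ v ∷ [] , (refl , refl , (w≁u ∘ sym) ∷ w≁v ∷ [-]) , ≤-refl
      where
      w = proj₁ (outside (part u))
      w≁u = proj₂ (outside (part u))
      w≁v : part w ≢ part v
      w≁v w∼v = w≁u (trans w∼v (sym u∼v))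

    isometric⇒shape : ∀ {p} → IsIsometricPath G p → Shape p
    isometric⇒shape {[]}             (_ , _ , (() , _) , _)
    isometric⇒shape {x ∷ []}         _ = point x
    isometric⇒shape {x ∷ y ∷ []}     (_ , _ , (_ , _ , x≁y ∷ _) , _) = edge x≁y
    isometric⇒shape {x ∷ y ∷ z ∷ []} (_ , _ , (h , l , x≁y ∷ _) , _ , shortest) with part z ≟ᶠ part x
    ... | yes z∼x = bend x≁y z∼x
    ... | no z≁x  = contradiction (shortest (x ∷ z ∷ []) (h , l , (z≁x ∘ sym) ∷ [-])) λ { (s≤s (s≤s ())) }
    isometric⇒shape {_ ∷ _ ∷ _ ∷ _ ∷ _} (u , v , _ , _ , shortest) =
      contradiction (≤-trans (shortest ws walk) length≤3) λ { (s≤s (s≤s (s≤s ()))) }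
      where
      ws = proj₁ (walk≤3 u v)
      walk = proj₁ (proj₂ (walk≤3 u v))
      length≤3 = proj₂ (proj₂ (walk≤3 u v))

  count : Fin r → List Vertex → ℕ
  count i = length ∘ filter (λ v → part v ≟ᶠ i)

  count-++ : ∀ i xs ys → count i (xs ++ ys) ≡ count i xs + count i ys
  count-++ i xs ys = trans (cong length (filter-++ (λ v → part v ≟ᶠ i) xs ys)) (length-++ (filter _ xs))

  count-∷ : ∀ i x xs → count i (x ∷ xs) ≡ count i [ x ] + count i xs
  count-∷ i x = count-++ i [ x ]

  count-concat : ∀ i xss → count i (concat xss) ≡ sum (map (count i) xss)
  count-concat i []         = refl
  count-concat i (xs ∷ xss) = trans (count-++ i xs (concat xss)) (cong (count i xs +_) (count-concat i xss))

  count-self : ∀ x → count (part x) [ x ] ≡ 1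
  count-self x with part x ≟ᶠ part x
  ... | yes _  = refl
  ... | no x≁x = contradiction refl x≁x

  count-other : ∀ {i} x → part x ≢ i → count i [ x ] ≡ 0
  count-other {i} x x≁i with part x ≟ᶠ i
  ... | yes x∼i = contradiction x∼i x≁i
  ... | no _    = refl

  count-single≤1 : ∀ {i} x → count i [ x ] ≤ 1
  count-single≤1 {i} x with part x ≟ᶠ i
  ... | yes _ = ≤-refl
  ... | no _  = z≤n

  count-part : ∀ {i x z} → part z ≡ part x → count i [ z ] ≡ count i [ x ]
  count-part {i} {j , _} {_ , _} refl with j ≟ᶠ i
  ... | yes _ = refl
  ... | no _  = refl

  count-distinct : ∀ {i x y} → part x ≢ part y → count i [ x ] + count i [ y ] ≤ 1
  count-distinct {i} {x} {y} x≁y with part x ≟ᶠ i | part y ≟ᶠ i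
  ... | yes x∼i | yes y∼i = contradiction (trans x∼i (sym y∼i)) x≁y
  ... | yes _   | no _    = ≤-refl
  ... | no _    | yes _   = ≤-refl
  ... | no _    | no _    = z≤n

  ∑-count : ∀ xs → ∑ (λ i → count i xs) ≡ length xs
  ∑-count []       = ∑-zero {r} (λ _ → refl)
  ∑-count (x ∷ xs) = begin
    ∑ (λ i → count i (x ∷ xs))                      ≡⟨ sum-cong-≗ (λ i → count-∷ i x xs) ⟩
    ∑ (λ i → count i [ x ] + count i xs)            ≡⟨ ∑-distrib-+ (λ i → count i [ x ]) (λ i → count i xs) ⟩
    ∑ (λ i → count i [ x ]) + ∑ (λ i → count i xs)  ≡⟨ cong₂ _+_ single (∑-count xs) ⟩
    suc (length xs)                                 ∎
    where
    open ≡-Reasoning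
    single : ∑ (λ i → count i [ x ]) ≡ 1
    single = trans (∑-concentrated (part x) (λ i i≢x → count-other x (i≢x ∘ sym))) (count-self x)

  shape-length : ∀ {p} → Shape p → length p ≤ 3
  shape-length (point _)  = s≤s z≤n
  shape-length (edge _)   = s≤s (s≤s z≤n)
  shape-length (bend _ _) = ≤-refl

  -- The first two vertices of an isometric path lie in distinct parts and meet every
  -- part the path meets.
  shape-take2-count≤1 : ∀ {p} i → Shape p → count i (take 2 p) ≤ 1
  shape-take2-count≤1 i (point x)            = count-single≤1 x
  shape-take2-count≤1 i (edge {x} {y} x≁y)   = ≤-trans (≤-reflexive (count-∷ i x [ y ])) (count-distinct x≁y)
  shape-take2-count≤1 i (bend {x} {y} x≁y _) = ≤-trans (≤-reflexive (count-∷ i x [ y ])) (count-distinct x≁y)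

  shape-⌈count/2⌉≤take2-count : ∀ {p} i → Shape p → ⌈ count i p /2⌉ ≤ count i (take 2 p)
  shape-⌈count/2⌉≤take2-count i (point x)                   = ⌈n/2⌉≤n _
  shape-⌈count/2⌉≤take2-count i (edge _)                    = ⌈n/2⌉≤n _
  shape-⌈count/2⌉≤take2-count i (bend {x} {y} {z} x≁y z∼x) = begin
    ⌈ count i (x ∷ y ∷ z ∷ []) /2⌉
      ≡⟨ cong ⌈_/2⌉ (trans (count-∷ i x _) (cong (cx +_) (count-∷ i y [ z ]))) ⟩
    ⌈ cx + (cy + count i [ z ]) /2⌉  ≡⟨ cong (λ cz → ⌈ cx + (cy + cz) /2⌉) (count-part z∼x) ⟩
    ⌈ cx + (cy + cx) /2⌉             ≤⟨ ⌈a+[b+a]/2⌉≤a+b cx cy (count-distinct x≁y) ⟩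
    cx + cy                          ≡⟨ count-∷ i x [ y ] ⟨
    count i (x ∷ y ∷ [])             ∎
    where
    open ≤-Reasoning
    cx = count i [ x ]
    cy = count i [ y ]
    ⌈a+[b+a]/2⌉≤a+b : ∀ a b → a + b ≤ 1 → ⌈ a + (b + a) /2⌉ ≤ a + b
    ⌈a+[b+a]/2⌉≤a+b zero          zero          _        = z≤n
    ⌈a+[b+a]/2⌉≤a+b zero          (suc zero)    _        = ≤-refl
    ⌈a+[b+a]/2⌉≤a+b (suc zero)    zero          _        = ≤-refl
    ⌈a+[b+a]/2⌉≤a+b zero          (suc (suc _)) (s≤s ())
    ⌈a+[b+a]/2⌉≤a+b (suc zero)    (suc _)       (s≤s ())
    ⌈a+[b+a]/2⌉≤a+b (suc (suc _)) _             (s≤s ())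

  covered⇒ns≤count : ∀ {xs} → (∀ x → x ∈ xs) → ∀ i → ns i ≤ count i xs
  covered⇒ns≤count covered i =
    injection≤length (i ,_) (λ { refl → refl }) (λ j → ∈-filter⁺ (λ v → part v ≟ᶠ i) (covered (i , j)) refl)

  cover-bounds : (∀ i → Σ Vertex λ w → part w ≢ i) → ∀ {ps} → IsIsoPathCover G ps → PathBounds (length ps) ns
  cover-bounds outside {ps} (isos , covered) = record { parts = parts ; size = size ; halves = halves }
    where
    open ≤-Reasoning
    L = length ps

    shapes : All Shape ps
    shapes = All.map (isometric⇒shape outside) isos

    ns≤count : ∀ i → ns i ≤ count i (concat ps)
    ns≤count = covered⇒ns≤count (∈-concat⁺ ∘ covered)

    ⌈ns/2⌉≤ : ∀ i → ⌈ ns i /2⌉ ≤ sum (map (count i ∘ take 2) ps)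
    ⌈ns/2⌉≤ i = begin
      ⌈ ns i /2⌉                           ≤⟨ ⌈n/2⌉-mono (ns≤count i) ⟩
      ⌈ count i (concat ps) /2⌉            ≡⟨ cong ⌈_/2⌉ (count-concat i ps) ⟩
      ⌈ sum (map (count i) ps) /2⌉         ≤⟨ ⌈sum/2⌉≤sum⌈/2⌉ (map (count i) ps) ⟩
      sum (map ⌈_/2⌉ (map (count i) ps))   ≡⟨ cong sum (map-∘ ps) ⟨
      sum (map (⌈_/2⌉ ∘ count i) ps)       ≤⟨ sum-map-mono (All.map (shape-⌈count/2⌉≤take2-count i) shapes) ⟩
      sum (map (count i ∘ take 2) ps)      ∎

    ⌈ns/2⌉≤L : ∀ i → ⌈ ns i /2⌉ ≤ 1 * L
    ⌈ns/2⌉≤L i = ≤-trans (⌈ns/2⌉≤ i) (sum-map-≤* (All.map (shape-take2-count≤1 i) shapes))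

    parts : ∀ i → ns i ≤ 2 * L
    parts i = begin
      ns i             ≤⟨ n≤2⌈n/2⌉ (ns i) ⟩
      2 * ⌈ ns i /2⌉   ≤⟨ *-monoʳ-≤ 2 (⌈ns/2⌉≤L i) ⟩
      2 * (1 * L)      ≡⟨ cong (2 *_) (*-identityˡ L) ⟩
      2 * L            ∎

    size : ∑ ns ≤ 3 * L
    size = begin
      ∑ ns                            ≤⟨ ∑-mono-≤ ns≤count ⟩
      ∑ (λ i → count i (concat ps))   ≡⟨ ∑-count (concat ps) ⟩
      length (concat ps)              ≡⟨ length-concat ps ⟩
      sum (map length ps)             ≤⟨ sum-map-≤* (All.map shape-length shapes) ⟩
      3 * L                           ∎

    halves : ∑ (⌈_/2⌉ ∘ ns) ≤ 2 * L
    halves = begin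
      ∑ (⌈_/2⌉ ∘ ns)                                ≤⟨ ∑-mono-≤ ⌈ns/2⌉≤ ⟩
      ∑ (λ i → sum (map (count i ∘ take 2) ps))     ≡⟨ sum-cong-≗ count-take2 ⟩
      ∑ (λ i → count i (concat (map (take 2) ps)))  ≡⟨ ∑-count (concat (map (take 2) ps)) ⟩
      length (concat (map (take 2) ps))             ≡⟨ length-concat (map (take 2) ps) ⟩
      sum (map length (map (take 2) ps))            ≡⟨ cong sum (map-∘ ps) ⟨
      sum (map (length ∘ take 2) ps)                ≤⟨ sum-map-≤* (All.universal length-take2≤2 ps) ⟩
      2 * L                                         ∎
      where
      count-take2 : ∀ i → sum (map (count i ∘ take 2) ps) ≡ count i (concat (map (take 2) ps))
      count-take2 i = trans (cong sum (map-∘ {g = count i} {f = take 2} ps)) (sym (count-concat i (map (take 2) ps)))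
      length-take2≤2 : (p : List Vertex) → length (take 2 p) ≤ 2
      length-take2≤2 p = ≤-trans (≤-reflexive (length-take 2 p)) (m⊓n≤m 2 (length p))

  record PartialCover (k : ℕ) (c : Fin r → ℕ) : Set where
    field
      paths     : List (List Vertex)
      isometric : All (IsIsometricPath G) paths
      length≡   : length paths ≡ k
      covers    : ∀ i (j : Fin (ns i)) → toℕ j < c i → Any ((i , j) ∈_) paths

  vertex : ∀ i {t} → t < ns i → Vertex
  vertex i t<n = i , fromℕ< t<n

  vertex-≡ : ∀ {i t} (t<n : t < ns i) (j : Fin (ns i)) → toℕ j ≡ t → (i , j) ≡ vertex i t<n
  vertex-≡ t<n j refl = cong (_ ,_) (sym (fromℕ<-toℕ j t<n))

  record TopPath (a : Fin r) (y : Vertex) (m : ℕ) : Set where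
    field
      path      : List Vertex
      isometric : IsIsometricPath G path
      through   : y ∈ path
      top       : ∀ (j : Fin (ns a)) → m ∸ 2 ≤ toℕ j → toℕ j < m → (a , j) ∈ path

  module _ {a y} (y≁a : part y ≢ a) where

    private
      edge-top : ∀ {m} → 0 < ns a → (∀ (j : Fin (ns a)) → toℕ j < m → toℕ j ≡ 0) → TopPath a y m
      edge-top 0<n top≡0 = record
        { path      = vertex a 0<n ∷ y ∷ []
        ; isometric = edge-isometric (y≁a ∘ sym)
        ; through   = there (here refl)
        ; top       = λ j _ j<m → here (vertex-≡ 0<n j (top≡0 j j<m))
        }

    topPath : ∀ {m} → 0 < ns a → m ≤ ns a → TopPath a y m
    topPath {zero}        0<n _     = edge-top 0<n λ _ ()
    topPath {suc zero}    0<n _     = edge-top 0<n λ _ j<1 → n<1⇒n≡0 j<1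
    topPath {suc (suc t)} _   t+2≤n = record
      { path      = x ∷ y ∷ z ∷ []
      ; isometric = bend-isometric (y≁a ∘ sym) refl x≢z
      ; through   = there (here refl)
      ; top       = top
      }
      where
      t<n = ≤-trans (n≤1+n _) t+2≤n
      x = vertex a t+2≤n
      z = vertex a t<n
      x≢z : x ≢ z
      x≢z x≡z = 1+n≢n (trans (sym (toℕ-fromℕ< t+2≤n)) (trans (cong (toℕ ∘ proj₂) x≡z) (toℕ-fromℕ< t<n)))
      top : ∀ (j : Fin (ns a)) → t ≤ toℕ j → toℕ j < 2 + t → (a , j) ∈ x ∷ y ∷ z ∷ []
      top j t≤j j<t+2 with m≤n⇒m<n∨m≡n t≤j
      ... | inj₁ t<j = here (vertex-≡ t+2≤n j (≤-antisym (s≤s⁻¹ j<t+2) t<j))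
      ... | inj₂ t≡j = there (there (here (vertex-≡ t<n j (sym t≡j))))

  module _ (nonempty : ∀ i → 0 < ns i) where

    extend : ∀ {k c a b} → a ≢ b → (∀ i → c i ≤ ns i) → PartialCover k (takePath a b c) → PartialCover (suc k) c
    extend {k} {c} {a} {b} a≢b c≤ns cover = record
      { paths     = T.path ∷ C.paths
      ; isometric = T.isometric ∷ C.isometric
      ; length≡   = cong suc C.length≡
      ; covers    = covers
      }
      where
      module C = PartialCover cover
      open TakePath a≢b c using (at-a; at-b; elsewhere)

      cb∸1<n : c b ∸ 1 < ns b
      cb∸1<n with c b | c≤ns b
      ... | zero  | _    = nonempty b
      ... | suc _ | cb≤n = cb≤n

      module T = TopPath (topPath {a} {vertex b cb∸1<n} (a≢b ∘ sym) (nonempty a) (c≤ns a))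

      newly-covered : ∀ i j → toℕ j < c i → ¬ toℕ j < takePath a b c i → (i , j) ∈ T.path
      newly-covered i j j<c j≮c′ with i ≟ᶠ a | i ≟ᶠ b
      ... | yes refl | _        = T.top j (≮⇒≥ (j≮c′ ∘ subst (toℕ j <_) (sym at-a))) j<c
      ... | no _     | yes refl =
        subst (_∈ T.path) (sym (vertex-≡ cb∸1<n j (squeeze j<c cb∸1≤j))) T.through
        where
        cb∸1≤j = ≮⇒≥ (j≮c′ ∘ subst (toℕ j <_) (sym at-b))
        squeeze : ∀ {t m} → t < m → m ∸ 1 ≤ t → t ≡ m ∸ 1
        squeeze {m = suc _} t<m m∸1≤t = ≤-antisym (s≤s⁻¹ t<m) m∸1≤t
      ... | no i≢a   | no i≢b   = contradiction (subst (toℕ j <_) (sym (elsewhere i i≢a i≢b)) j<c) j≮c′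

      covers : ∀ i (j : Fin (ns i)) → toℕ j < c i → Any ((i , j) ∈_) (T.path ∷ C.paths)
      covers i j j<c with toℕ j <? takePath a b c i
      ... | yes j<c′ = there (C.covers i j j<c′)
      ... | no j≮c′  = here (newly-covered i j j<c j≮c′)

module _ {m} (ns : Fin (2 + m) → ℕ) (nonempty : ∀ i → 0 < ns i) where
  open Multipartite ns

  build : ∀ {k c} → PathBounds k c → (∀ i → c i ≤ ns i) → PartialCover k c
  build {zero} bounds _ = record
    { paths = [] ; isometric = [] ; length≡ = refl
    ; covers = λ i j j<c → contradiction (≤-trans j<c (PathBounds.parts bounds i)) λ ()
    }
  build {suc k} {c} bounds c≤ns with largest c
  ... | a , max with takePath-bounds bounds max
  ...   | b , a≢b , bounds′ = extend nonempty a≢b c≤ns (build bounds′ (λ i → ≤-trans (decreasing i) (c≤ns i)))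
      where open TakePath a≢b c using (decreasing)

  ip-of-least-bounds : ∀ {K} → PathBounds K ns → (∀ L → PathBounds L ns → K ≤ L) → IsometricPathNumber G K
  ip-of-least-bounds bounds least =
    (C.paths , (C.isometric , λ (i , j) → C.covers i j (toℕ<n j)) , C.length≡) ,
    λ ps cover → least (length ps) (cover-bounds outside cover)
    where
    module C = PartialCover (build bounds (λ _ → ≤-refl))
    outside : ∀ i → Σ Vertex λ w → part w ≢ i
    outside i = vertex (another i) (nonempty (another i)) , another≢ i

-- The three cases

≤suc*⌈/suc⌉ : ∀ a b → a ≤ suc b * ⌈ a /suc b ⌉
≤suc*⌈/suc⌉ a b = +-cancelʳ-≤ b a _ (begin
  a + b                                   ≡⟨ m≡m%n+[m/n]*n (a + b) (suc b) ⟩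
  (a + b) % suc b + ⌈ a /suc b ⌉ * suc b  ≤⟨ +-monoˡ-≤ _ (s≤s⁻¹ (m%n<n (a + b) (suc b))) ⟩
  b + ⌈ a /suc b ⌉ * suc b
    ≡⟨ solve 2 (λ b k → b :+ k :* (con 1 :+ b) := (con 1 :+ b) :* k :+ b) refl b _ ⟩
  suc b * ⌈ a /suc b ⌉ + b                ∎)
  where open ≤-Reasoning

⌈/suc⌉-least : ∀ {a b L} → a ≤ suc b * L → ⌈ a /suc b ⌉ ≤ L
⌈/suc⌉-least {a} {b} {L} a≤ = s≤s⁻¹ (m<n*o⇒m/o<n (begin-strict
  a + b                  ≤⟨ +-monoˡ-≤ b a≤ ⟩
  suc b * L + b          <⟨ +-monoʳ-< (suc b * L) (n<1+n b) ⟩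
  suc b * L + suc b
    ≡⟨ solve 2 (λ b l → (con 1 :+ b) :* l :+ (con 1 :+ b) := (con 1 :+ l) :* (con 1 :+ b)) refl b L ⟩
  suc L * suc b          ∎))
  where open ≤-Reasoning

total≡∑ : ∀ r (c : Fin r → ℕ) → total r c ≡ ∑ c
total≡∑ zero    c = refl
total≡∑ (suc r) c = cong (c zero +_) (total≡∑ r (c ∘ suc))

length-filter-odd : ∀ xs → length (filter (λ m → m % 2 ≟ 1) xs) ≡ sum (map (_% 2) xs)
length-filter-odd []       = refl
length-filter-odd (x ∷ xs) with x % 2 | n%2≤1 x
... | zero        | _      = length-filter-odd xs
... | suc zero    | _      = cong suc (length-filter-odd xs)
... | suc (suc _) | s≤s ()

oddCount≡∑ : ∀ r (c : Fin r → ℕ) → oddCount r c ≡ ∑ (λ i → c i % 2)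
oddCount≡∑ r c = begin
  oddCount r c                     ≡⟨ length-filter-odd (tabulate c) ⟩
  sum (map (_% 2) (tabulate c))    ≡⟨ cong sum (map-tabulate c (_% 2)) ⟩
  total r (λ i → c i % 2)          ≡⟨ total≡∑ r (λ i → c i % 2) ⟩
  ∑ (λ i → c i % 2)                ∎
  where open ≡-Reasoning

module _ {m} (ns : Fin (2 + m) → ℕ) (sorted : ∀ i → ns i ≤ ns zero) (nonempty : ∀ i → 0 < ns i) where
  open Multipartite ns using (G)

  private
    n₁ n α H R : ℕ
    n₁ = ns zero
    n  = ∑ ns
    α  = ∑ (λ i → ns i % 2)
    H  = ∑ (⌈_/2⌉ ∘ ns)
    R  = ∑ (ns ∘ suc)

    2H≡n+α : 2 * H ≡ n + α
    2H≡n+α = sym (size+odd≡2*halves ns)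

    halves≤⇒n+α≤ : ∀ K → H ≤ 2 * K → n + α ≤ 4 * K
    halves≤⇒n+α≤ K H≤ =
      ≤-trans (≤-reflexive (sym 2H≡n+α)) (≤-trans (*-monoʳ-≤ 2 H≤) (≤-reflexive (sym (*-assoc 2 2 K))))

    n+α≤⇒halves≤ : ∀ K → n + α ≤ 4 * K → H ≤ 2 * K
    n+α≤⇒halves≤ K n+α≤ =
      *-cancelˡ-≤ 2 (≤-trans (≤-reflexive 2H≡n+α) (≤-trans n+α≤ (≤-reflexive (*-assoc 2 2 K))))

  ip-characterisation : ∀ {K} → n₁ ≤ 2 * K → n ≤ 3 * K → n + α ≤ 4 * K
    → (∀ {L} → n₁ ≤ 2 * L → n ≤ 3 * L → n + α ≤ 4 * L → K ≤ L)
    → IsometricPathNumber G K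
  ip-characterisation {K} n₁≤ n≤ n+α≤ least = ip-of-least-bounds ns nonempty
    (record { parts = λ i → ≤-trans (sorted i) n₁≤ ; size = n≤ ; halves = n+α≤⇒halves≤ K n+α≤ })
    (λ L bounds → let open PathBounds bounds in least (parts zero) size (halves≤⇒n+α≤ L halves))

  ip-when-largest-part-dominates : 2 * n < 3 * n₁ → IsometricPathNumber G ⌈ n₁ /suc 1 ⌉
  ip-when-largest-part-dominates 2n<3n₁ =
    ip-characterisation n₁≤2K n≤3K (halves≤⇒n+α≤ K H≤2K) (λ n₁≤2L _ _ → ⌈/suc⌉-least n₁≤2L)
    where
    open ≤-Reasoning
    K = ⌈ n₁ /suc 1 ⌉
    n₁≤2K : n₁ ≤ 2 * K
    n₁≤2K = ≤suc*⌈/suc⌉ n₁ 1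
    n≤3K : n ≤ 3 * K
    n≤3K = <⇒≤ (*-cancelˡ-< 2 n (3 * K) (begin-strict
      2 * n          <⟨ 2n<3n₁ ⟩
      3 * n₁         ≤⟨ *-monoʳ-≤ 3 n₁≤2K ⟩
      3 * (2 * K)    ≡⟨ solve 1 (λ k → con 3 :* (con 2 :* k) := con 2 :* (con 3 :* k)) refl K ⟩
      2 * (3 * K)    ∎))
    2R<n₁ : 2 * R < n₁
    2R<n₁ = +-cancelˡ-< (2 * n₁) (2 * R) n₁ (begin-strict
      2 * n₁ + 2 * R ≡⟨ *-distribˡ-+ 2 n₁ R ⟨
      2 * n          <⟨ 2n<3n₁ ⟩
      3 * n₁         ≡⟨ solve 1 (λ x → con 3 :* x := con 2 :* x :+ x) refl n₁ ⟩
      2 * n₁ + n₁    ∎)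
    H≤2K : H ≤ 2 * K
    H≤2K = begin
      ⌈ n₁ /2⌉ + ∑ (⌈_/2⌉ ∘ ns ∘ suc)
        ≤⟨ +-mono-≤ (n≤2k⇒⌈n/2⌉≤k {k = K} n₁≤2K) (∑-mono-≤ (λ i → ⌈n/2⌉≤n (ns (suc i)))) ⟩
      K + R
        ≤⟨ +-monoʳ-≤ K (*-cancelˡ-≤ {R} {K} 2 (≤-trans (<⇒≤ 2R<n₁) n₁≤2K)) ⟩
      K + K
        ≡⟨ solve 1 (λ k → k :+ k := con 2 :* k) refl K ⟩
      2 * K                             ∎

  ip-when-many-odd-parts : n < 3 * α → IsometricPathNumber G ⌈ n + α /suc 3 ⌉
  ip-when-many-odd-parts n<3α =
    ip-characterisation n₁≤2K n≤3K n+α≤4K (λ _ _ n+α≤4L → ⌈/suc⌉-least n+α≤4L)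
    where
    open ≤-Reasoning
    K = ⌈ n + α /suc 3 ⌉
    n+α≤4K : n + α ≤ 4 * K
    n+α≤4K = ≤suc*⌈/suc⌉ (n + α) 3
    n≤3K : n ≤ 3 * K
    n≤3K = <⇒≤ (*-cancelˡ-< 4 n (3 * K) (begin-strict
      4 * n            ≡⟨ solve 1 (λ x → con 4 :* x := con 3 :* x :+ x) refl n ⟩
      3 * n + n        <⟨ +-monoʳ-< (3 * n) n<3α ⟩
      3 * n + 3 * α    ≡⟨ *-distribˡ-+ 3 n α ⟨
      3 * (n + α)      ≤⟨ *-monoʳ-≤ 3 n+α≤4K ⟩
      3 * (4 * K)      ≡⟨ solve 1 (λ k → con 3 :* (con 4 :* k) := con 4 :* (con 3 :* k)) refl K ⟩
      4 * (3 * K)      ∎))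
    α≤1+R : α ≤ 1 + R
    α≤1+R = +-mono-≤ (n%2≤1 n₁) (∑-mono-≤ (λ i → m%n≤m (ns (suc i)) 2))
    n₁≤α+1+R : n₁ ≤ α + 1 + R
    n₁≤α+1+R = +-cancelʳ-≤ (1 + R) n₁ (α + 1 + R) (begin
      n₁ + (1 + R)              ≡⟨ +-suc n₁ R ⟩
      1 + n                     ≤⟨ n<3α ⟩
      3 * α                     ≡⟨ solve 1 (λ a → con 3 :* a := a :+ (a :+ a)) refl α ⟩
      α + (α + α)               ≤⟨ +-monoʳ-≤ α (+-mono-≤ α≤1+R α≤1+R) ⟩
      α + ((1 + R) + (1 + R))   ≡⟨ solve 2 (λ a r → a :+ (con 1 :+ r :+ (con 1 :+ r)) := a :+ con 1 :+ r :+ (con 1 :+ r))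
                                           refl α R ⟩
      α + 1 + R + (1 + R)       ∎)
    n₁≤2K : n₁ ≤ 2 * K
    n₁≤2K = s≤s⁻¹ (*-cancelˡ-< 2 n₁ (1 + 2 * K) (begin-strict
      2 * n₁                    ≡⟨ solve 1 (λ x → con 2 :* x := x :+ x) refl n₁ ⟩
      n₁ + n₁                   ≤⟨ +-monoʳ-≤ n₁ n₁≤α+1+R ⟩
      n₁ + (α + 1 + R)          ≡⟨ solve 3 (λ x a r → x :+ (a :+ con 1 :+ r) := x :+ r :+ a :+ con 1) refl n₁ α R ⟩
      n + α + 1                 ≤⟨ +-monoˡ-≤ 1 n+α≤4K ⟩
      4 * K + 1                 <⟨ n<1+n _ ⟩
      1 + (4 * K + 1)           ≡⟨ solve 1 (λ k → con 1 :+ (con 4 :* k :+ con 1) := con 2 :* (con 1 :+ con 2 :* k))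
                                           refl K ⟩
      2 * (1 + 2 * K)           ∎))

  ip-when-balanced : 3 * α ≤ n → 3 * n₁ ≤ 2 * n → IsometricPathNumber G ⌈ n /suc 2 ⌉
  ip-when-balanced 3α≤n 3n₁≤2n =
    ip-characterisation n₁≤2K n≤3K n+α≤4K (λ _ n≤3L _ → ⌈/suc⌉-least n≤3L)
    where
    open ≤-Reasoning
    K = ⌈ n /suc 2 ⌉
    n≤3K : n ≤ 3 * K
    n≤3K = ≤suc*⌈/suc⌉ n 2
    n₁≤2K : n₁ ≤ 2 * K
    n₁≤2K = *-cancelˡ-≤ 3 (begin
      3 * n₁         ≤⟨ 3n₁≤2n ⟩
      2 * n          ≤⟨ *-monoʳ-≤ 2 n≤3K ⟩
      2 * (3 * K)    ≡⟨ solve 1 (λ k → con 2 :* (con 3 :* k) := con 3 :* (con 2 :* k)) refl K ⟩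
      3 * (2 * K)    ∎)
    n+α≤4K : n + α ≤ 4 * K
    n+α≤4K = *-cancelˡ-≤ 3 (begin
      3 * (n + α)    ≡⟨ *-distribˡ-+ 3 n α ⟩
      3 * n + 3 * α  ≤⟨ +-monoʳ-≤ (3 * n) 3α≤n ⟩
      3 * n + n      ≡⟨ solve 1 (λ x → con 3 :* x :+ x := con 4 :* x) refl n ⟩
      4 * n          ≤⟨ *-monoʳ-≤ 4 n≤3K ⟩
      4 * (3 * K)    ≡⟨ solve 1 (λ k → con 4 :* (con 3 :* k) := con 3 :* (con 4 :* k)) refl K ⟩
      3 * (4 * K)    ∎)

theorem4 : (m : ℕ) → (ns : Fin (2 + m) → ℕ)
    → (∀ i j → i Data.Fin.≤ j → ns j Data.Nat.≤ ns i)
    → (∀ i → 1 Data.Nat.≤ ns i)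
    → (2 * total (2 + m) ns < 3 * ns zero
         → IsometricPathNumber (CompleteMultipartite (2 + m) ns) ⌈ ns zero /suc 1 ⌉)
      × (total (2 + m) ns < 3 * oddCount (2 + m) ns
         → IsometricPathNumber (CompleteMultipartite (2 + m) ns)
             ⌈ total (2 + m) ns + oddCount (2 + m) ns /suc 3 ⌉)
      × (3 * oddCount (2 + m) ns Data.Nat.≤ total (2 + m) ns
         → 3 * ns zero Data.Nat.≤ 2 * total (2 + m) ns
         → IsometricPathNumber (CompleteMultipartite (2 + m) ns) ⌈ total (2 + m) ns /suc 2 ⌉)
theorem4 m ns sorted nonempty rewrite total≡∑ (2 + m) ns | oddCount≡∑ (2 + m) ns =
    ip-when-largest-part-dominates ns largest-first nonempty
  , ip-when-many-odd-parts ns largest-first nonempty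
  , ip-when-balanced ns largest-first nonempty
  where
  largest-first : ∀ i → ns i ≤ ns zero
  largest-first i = sorted zero i z≤n
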